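{- $\mathrm{gfp}^{\subseteq}\, F^\bot = \emptyset$ if and only if $\{\sigma\in\mathbb{N}\rightarrow\Sigma\mid\forall i\in\mathbb{N}\,.\,\langle\sigma_i,\sigma_{i+1}\rangle\in [\![\texttt{B}]\!]\,;\,[\![\texttt{S}]\!]^e\}=\emptyset$, where $;$ denotes left relational composition $r_1 ; r_2 \triangleq\{\langle x,z\rangle\mid\exists y\,.\,\langle x,y\rangle\in r_1\wedge\langle y,z\rangle\in r_2\}$.
   Context: Consider a loop $\texttt{while (B) S}$ in an imperative language with states $\Sigma$ and nontermination denoted $\bot\notin\Sigma$. $[\![\texttt{S}]\!]^e\in\wp(\Sigma\times\Sigma)$ is the relational semantics of normal termination of the loop body $\texttt{S}$, and $[\![\texttt{B}]\!]\triangleq\{\langle\sigma,\sigma\rangle\mid\sigma\in\mathcal{B}[\![\texttt{B}]\!]\}$ is the relational semantics of the Boolean test (with $\mathcal{B}[\![\texttt{B}]\!]\subseteq\Sigma$ the states satisfying $\texttt{B}$). The transformer is $F^\bot(X)\triangleq[\![\texttt{B}]\!]\,;\,[\![\texttt{S}]\!]^e\,;\,X$ for $X\in\wp(\Sigma\times\{\bot\})$, an increasing map on the complete lattice $\langle\wp(\Sigma\times\{\bot\}),\subseteq\rangle$, and $\mathrm{gfp}^{\subseteq} F^\bot$ is its greatest fixpoint (the infinitely-iterating nontermination part of the loop semantics). Relational composition is extended to $\bot$ by $r ; r'\triangleq\{\langle x,\bot\rangle\mid\langle x,\bot\rangle\in r\}\cup\{\langle x,y\rangle\mid\exists z\in\Sigma\,.\,\langle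 x,z\rangle\in r\wedge\langle z,y\rangle\in r'\}$. -}

module Defs where

open import Level using (Level; suc; _⊔_)
open import Data.Product using (Σ; ∃; _×_; _,_)
open import Data.Sum using (_⊎_)
open import Data.Empty.Polymorphic using (⊥)
open import Relation.Binary.PropositionalEquality using (_≡_)
open import Relation.Nullary using (¬_)

private variable ℓ : Level

-- States extended with nontermination: St⊥ S = S ∪ {⊥}
data St⊥ (S : Set ℓ) : Set ℓ where
  st  : S → St⊥ S
  bot : St⊥ S

Rel : Set ℓ → Set (suc ℓ)
Rel {ℓ} S = S → S → Set ℓ

Rel⊥ : Set ℓ → Set (suc ℓ)
Rel⊥ {ℓ} S = S → St⊥ S → Set ℓ

-- Subsets of Σ × {⊥}, identified with predicates on Σ
Pred⊥ : Set ℓ → Set (suc ℓ)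
Pred⊥ {ℓ} S = S → Set ℓ

_⨾_ : {S : Set ℓ} → Rel S → Rel S → Rel S
(r ⨾ r') x z = ∃ λ y → r x y × r' y z

_⨾⊥_ : {S : Set ℓ} → Rel⊥ S → Rel⊥ S → Rel⊥ S
(r ⨾⊥ r') x y = (y ≡ bot × r x bot) ⊎ (∃ λ z → r x (st z) × r' z y)

ι : {S : Set ℓ} → Rel S → Rel⊥ S
ι r x (st y) = r x y
ι r x bot = ⊥

ι⊥ : {S : Set ℓ} → Pred⊥ S → Rel⊥ S
ι⊥ X x y = y ≡ bot × X x

⟦_⟧ᵇ : {S : Set ℓ} → (S → Set ℓ) → Rel S
⟦ B ⟧ᵇ x y = x ≡ y × B x

_⊆_ : {S : Set ℓ} → Pred⊥ S → Pred⊥ S → Set ℓ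
X ⊆ Y = ∀ x → X x → Y x

-- F^⊥(X) = ⟦B⟧ ; ⟦S⟧ᵉ ; X   (its result only contains pairs ⟨x,⊥⟩)
F⊥ : {S : Set ℓ} → (S → Set ℓ) → Rel S → Pred⊥ S → Pred⊥ S
F⊥ B Se X x = ((ι ⟦ B ⟧ᵇ ⨾⊥ ι Se) ⨾⊥ ι⊥ X) x bot

-- greatest fixpoint (Knaster–Tarski): union of all post-fixpoints
gfp : {S : Set ℓ} → (Pred⊥ S → Pred⊥ S) → S → Set (suc ℓ)
gfp {ℓ} {S} F x = ∃ λ (X : Pred⊥ S) → X ⊆ F X × X x

IsEmpty : ∀ {a b} {A : Set a} → (A → Set b) → Set (a ⊔ b)
IsEmpty P = ∀ x → ¬ P x

-- Modulo bookkeeping with ⊥, F⊥ X is the existential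
-- preimage of X under r = ⟦B⟧ ; ⟦S⟧ᵉ, and a set is a post-fixpoint of that
-- preimage map exactly when each of its points has an r-successor inside it:
-- following successors from a point of a post-fixpoint builds an infinite
-- r-chain, and conversely the range of an infinite r-chain is a post-fixpoint.
module Submission where

open import Defs
open import Level using (Level)
open import Data.Nat using (ℕ; suc; zero)
open import Function.Bundles using (_⇔_; mk⇔)
open import Data.Product using (Σ; ∃; _×_; _,_; proj₁; proj₂)
open import Data.Sum using (inj₁; inj₂)
open import Relation.Binary.PropositionalEquality using (_≡_; refl)

private variable ℓ : Level

pre : {S : Set ℓ} → Rel S → Pred⊥ S → Pred⊥ S
pre R X x = ∃ λ z → R x z × X z

Chain : {S : Set ℓ} → Rel S → (ℕ → S) → Set ℓ
Chain R σ = ∀ i → R (σ i) (σ (suc i))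

range : {S : Set ℓ} → (ℕ → S) → Pred⊥ S
range σ x = ∃ λ i → σ i ≡ x

gfp-mono : {S : Set ℓ} {F G : Pred⊥ S → Pred⊥ S} →
           (∀ X → F X ⊆ G X) → ∀ x → gfp F x → gfp G x
gfp-mono F⊆G x (X , X⊆FX , Xx) = X , (λ y Xy → F⊆G X y (X⊆FX y Xy)) , Xx

module _ {S : Set ℓ} (R : Rel S) where

  range-postfixed : {σ : ℕ → S} → Chain R σ → range σ ⊆ pre R (range σ)
  range-postfixed {σ} chain x (i , refl) = σ (suc i) , chain i , suc i , refl

  Chain⇒gfp-pre : {σ : ℕ → S} → Chain R σ → gfp (pre R) (σ zero)
  Chain⇒gfp-pre chain = range _ , range-postfixed chain , zero , refl

  gfp-pre⇒Chain : ∀ x → gfp (pre R) x → ∃ λ σ → Chain R σ × σ zero ≡ x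
  gfp-pre⇒Chain x (X , X⊆preX , Xx) = (λ i → proj₁ (walk i)) , step , refl
    where
    walk : ℕ → Σ S X
    walk zero = x , Xx
    walk (suc i) with X⊆preX (proj₁ (walk i)) (proj₂ (walk i))
    ... | z , _ , Xz = z , Xz

    step : Chain R (λ i → proj₁ (walk i))
    step i with X⊆preX (proj₁ (walk i)) (proj₂ (walk i))
    ... | _ , Rxz , _ = Rxz

module _ {S : Set ℓ} (B : S → Set ℓ) (Se : Rel S) where

  F⊥⊆pre : ∀ X → F⊥ B Se X ⊆ pre (⟦ B ⟧ᵇ ⨾ Se) X
  F⊥⊆pre X x (inj₁ (_ , inj₁ (_ , ())))
  F⊥⊆pre X x (inj₁ (_ , inj₂ (_ , _ , ())))
  F⊥⊆pre X x (inj₂ (_ , inj₁ (() , _) , _))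
  F⊥⊆pre X x (inj₂ (z , inj₂ (y , Bxy , Syz) , _ , Xz)) = z , (y , Bxy , Syz) , Xz

  pre⊆F⊥ : ∀ X → pre (⟦ B ⟧ᵇ ⨾ Se) X ⊆ F⊥ B Se X
  pre⊆F⊥ X x (z , (y , Bxy , Syz) , Xz) = inj₂ (z , inj₂ (y , Bxy , Syz) , refl , Xz)

mainTheorem1 : ∀ {ℓ : Level} {S : Set ℓ} (B : S → Set ℓ) (Se : Rel S) →
    IsEmpty (gfp (F⊥ B Se))
    ⇔ IsEmpty (λ (σ : ℕ → S) → ∀ i → (⟦ B ⟧ᵇ ⨾ Se) (σ i) (σ (suc i)))
mainTheorem1 B Se = mk⇔ noChain noGfp
  where
  noChain : IsEmpty (gfp (F⊥ B Se)) → IsEmpty (Chain (⟦ B ⟧ᵇ ⨾ Se))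
  noChain empty σ chain =
    empty (σ zero) (gfp-mono (pre⊆F⊥ B Se) (σ zero) (Chain⇒gfp-pre _ chain))

  noGfp : IsEmpty (Chain (⟦ B ⟧ᵇ ⨾ Se)) → IsEmpty (gfp (F⊥ B Se))
  noGfp empty x g with gfp-pre⇒Chain _ x (gfp-mono (F⊥⊆pre B Se) x g)
  ... | σ , chain , _ = empty σ chain
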